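{- For every set $A$ of four positive integers, $d_2(A)\le 4$. Moreover, $d_2(A)=4$ if and only if $A=\{a,5a,7a,11a\}$ or $A=\{a,11a,19a,29a\}$ for some positive integer $a$.
   Context: For a finite set $A$ of positive integers, write $\sum A$ for the sum of its elements. A subset $B\subseteq A$ is a divisor of $A$ if $\sum B$ divides $\sum A$. $d_2(A)$ denotes the number of 2-element subsets of $A$ that are divisors of $A$. -}

module Defs where

open import Data.Nat using (ℕ; _+_)
open import Data.Nat.Divisibility using (_∣?_)
open import Data.List using (List; []; _∷_; map; _++_; filter; length)
open import Data.Nat.ListAction using (sum)
open import Data.Product using (_×_; _,_; proj₁; proj₂)

-- All 2-element subsets {x,y} of a list without duplicates, each listed once,
-- as ordered pairs (x appears before y in the list).
pairs : List ℕ → List (ℕ × ℕ)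
pairs []       = []
pairs (x ∷ xs) = map (x ,_) xs ++ pairs xs

d₂ : List ℕ → ℕ
d₂ A = length (filter (λ p → (proj₁ p + proj₂ p) ∣? sum A) (pairs A))

-- Sort A as a < b < c < d and put S = a + b + c + d.  The pair sums b + d and c + d exceed S / 2,
-- so they never divide S, whence d₂(A) ≤ 4.  If the other four pair sums all divide S, then the
-- complementary sums a + d and b + c divide each other and are equal.  With b = a + u, c = b + v
-- (and so d = c + u) the quotient S / (a + c) lies strictly between 2 and 4, forcing u = 2a + v;
-- then S / (a + b) lies strictly between 3 and 6, and the quotients 4 and 5 give v = 2a and v = 8a,
-- i.e. the two families.  Conversely d₂ is invariant under scaling, and {1, 5, 7, 11} and
-- {1, 11, 19, 29} are checked by evaluation.
module Submission where

open import Defs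
open import Data.Nat using (ℕ; _*_; _≤_; _<_)
open import Data.List using (List; []; _∷_; length)
open import Data.List.Relation.Unary.All using (All)
open import Data.List.Relation.Unary.Unique.Propositional using (Unique)
open import Data.List.Relation.Binary.Permutation.Propositional using (_↭_)
open import Data.Product using (_×_; Σ)
open import Data.Sum using (_⊎_)
open import Relation.Binary.PropositionalEquality using (_≡_)
open import Function.Bundles using (_⇔_)

open import Data.Bool using (true; false)
open import Data.Nat using (suc; z≤n; s≤s; s≤s⁻¹; _+_; _∸_; NonZero; >-nonZero)
open import Data.Nat.Properties
open import Data.Nat.Divisibility
  using (_∣_; _∤_; _∣?_; divides; ∣-refl; ∣-antisym; ∣m+n∣m⇒∣n; ∣⇒≤; *-cancelʳ-∣; *-monoˡ-∣)
open import Data.Nat.ListAction using (sum)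
open import Data.Nat.ListAction.Properties using (sum-↭)
open import Data.Nat.Tactic.RingSolver using (solve)
open import Data.List using (map; _++_; filter)
open import Data.List.Properties
  using (map-++; map-∘; map-cong; ++-identityʳ; length-filter; filter-++; filter-none; filter-all; filter-complete; filter-≐)
import Data.List.Relation.Unary.All as All
open import Data.List.Relation.Unary.All.Properties using (all-filter)
import Data.List.Relation.Unary.AllPairs as AllPairs
open import Data.List.Relation.Unary.Linked as Linked using (Linked; [-])
open import Data.List.Sort ≤-decTotalOrder using (sort; sort-↭; sort-↗)
open import Data.List.Relation.Binary.Permutation.Propositional using (refl; prep; swap; trans; ↭-sym; ↭⇒↭ₛ)
open import Data.List.Relation.Binary.Permutation.Propositional.Properties
  using (map⁺; ++⁺; shifts; filter-↭; ↭-length; All-resp-↭)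
open import Data.List.Relation.Binary.Permutation.Setoid.Properties using (Unique-resp-↭)
open import Data.Product using (_,_; ∃-syntax; uncurry)
open import Data.Sum using (inj₁; inj₂)
import Data.Sum as Sum
open import Function.Bundles using (mk⇔; Equivalence)
open import Relation.Nullary using (does)
open import Relation.Unary using (Pred; Decidable)
import Relation.Binary.PropositionalEquality as ≡
open import Relation.Binary.PropositionalEquality.Properties using (setoid)
open ≡ using (cong; cong₂; subst; sym)
open ≡.≡-Reasoning

length-filter-map : ∀ {A B : Set} {p} {P : Pred B p} (P? : Decidable P) (f : A → B) xs →
  length (filter P? (map f xs)) ≡ length (filter (λ x → P? (f x)) xs)
length-filter-map P? f []       = ≡.refl
length-filter-map P? f (x ∷ xs) with does (P? (f x))
... | true  = cong suc (length-filter-map P? f xs)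
... | false = length-filter-map P? f xs

pairSums : List ℕ → List ℕ
pairSums []       = []
pairSums (x ∷ xs) = map (x +_) xs ++ pairSums xs

map-sum-pairs : ∀ xs → map (uncurry _+_) (pairs xs) ≡ pairSums xs
map-sum-pairs []       = ≡.refl
map-sum-pairs (x ∷ xs) = begin
  map (uncurry _+_) (map (x ,_) xs ++ pairs xs)                ≡⟨ map-++ (uncurry _+_) (map (x ,_) xs) (pairs xs) ⟩
  map (uncurry _+_) (map (x ,_) xs) ++ map (uncurry _+_) (pairs xs) ≡⟨ cong₂ _++_ (sym (map-∘ xs)) (map-sum-pairs xs) ⟩
  map (x +_) xs ++ pairSums xs                                 ∎

pairSums-↭ : ∀ {xs ys} → xs ↭ ys → pairSums xs ↭ pairSums ys
pairSums-↭ refl         = refl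
pairSums-↭ (prep x p)   = ++⁺ (map⁺ (x +_) p) (pairSums-↭ p)
pairSums-↭ {x ∷ y ∷ xs} {y ∷ x ∷ ys} (swap x y p) rewrite +-comm x y =
  prep (y + x) (trans (++⁺ (map⁺ (x +_) p) (++⁺ (map⁺ (y +_) p) (pairSums-↭ p)))
                      (shifts (map (x +_) ys) (map (y +_) ys)))
pairSums-↭ (trans p q)  = trans (pairSums-↭ p) (pairSums-↭ q)

d₂-pairSums : ∀ A → d₂ A ≡ length (filter (_∣? sum A) (pairSums A))
d₂-pairSums A = begin
  d₂ A                                                   ≡⟨ sym (length-filter-map (_∣? sum A) (uncurry _+_) (pairs A)) ⟩
  length (filter (_∣? sum A) (map (uncurry _+_) (pairs A))) ≡⟨ cong (λ ys → length (filter (_∣? sum A) ys)) (map-sum-pairs A) ⟩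
  length (filter (_∣? sum A) (pairSums A))               ∎

d₂-↭ : ∀ {A B} → A ↭ B → d₂ A ≡ d₂ B
d₂-↭ {A} {B} p = begin
  d₂ A                                       ≡⟨ d₂-pairSums A ⟩
  length (filter (_∣? sum A) (pairSums A))   ≡⟨ cong (λ n → length (filter (_∣? n) (pairSums A))) (sum-↭ p) ⟩
  length (filter (_∣? sum B) (pairSums A))   ≡⟨ ↭-length (filter-↭ (_∣? sum B) (pairSums-↭ p)) ⟩
  length (filter (_∣? sum B) (pairSums B))   ≡⟨ sym (d₂-pairSums B) ⟩
  d₂ B                                       ∎

sum-map-* : ∀ a xs → sum (map (_* a) xs) ≡ sum xs * a
sum-map-* a []       = ≡.refl
sum-map-* a (x ∷ xs) = ≡.trans (cong (x * a +_) (sum-map-* a xs)) (sym (*-distribʳ-+ a x (sum xs)))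

pairSums-map-* : ∀ a xs → pairSums (map (_* a) xs) ≡ map (_* a) (pairSums xs)
pairSums-map-* a []       = ≡.refl
pairSums-map-* a (x ∷ xs) = begin
  map (x * a +_) (map (_* a) xs) ++ pairSums (map (_* a) xs) ≡⟨ cong₂ _++_ (sym (map-∘ xs)) (pairSums-map-* a xs) ⟩
  map (λ y → x * a + y * a) xs ++ map (_* a) (pairSums xs)  ≡⟨ cong (_++ _) (map-cong (λ y → sym (*-distribʳ-+ a x y)) xs) ⟩
  map (λ y → (x + y) * a) xs ++ map (_* a) (pairSums xs)    ≡⟨ cong (_++ _) (map-∘ xs) ⟩
  map (_* a) (map (x +_) xs) ++ map (_* a) (pairSums xs)    ≡⟨ sym (map-++ (_* a) (map (x +_) xs) (pairSums xs)) ⟩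
  map (_* a) (map (x +_) xs ++ pairSums xs)                 ∎

d₂-map-* : ∀ a .{{_ : NonZero a}} A → d₂ (map (_* a) A) ≡ d₂ A
d₂-map-* a A = begin
  d₂ (map (_* a) A)                                                   ≡⟨ d₂-pairSums (map (_* a) A) ⟩
  length (filter (_∣? sum (map (_* a) A)) (pairSums (map (_* a) A))) ≡⟨ cong₂ (λ n ys → length (filter (_∣? n) ys)) (sum-map-* a A) (pairSums-map-* a A) ⟩
  length (filter (_∣? sum A * a) (map (_* a) (pairSums A)))          ≡⟨ length-filter-map (_∣? sum A * a) (_* a) (pairSums A) ⟩
  length (filter (λ x → x * a ∣? sum A * a) (pairSums A))             ≡⟨ cong length (filter-≐ _ _ (*-cancelʳ-∣ a , *-monoˡ-∣ a) (pairSums A)) ⟩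
  length (filter (_∣? sum A) (pairSums A))                           ≡⟨ sym (d₂-pairSums A) ⟩
  d₂ A                                                               ∎

strictify : ∀ {xs} → Linked _≤_ xs → Unique xs → Linked _<_ xs
strictify Linked.[]          _                                       = Linked.[]
strictify [-]                _                                       = [-]
strictify (x≤y Linked.∷ xs↗) ((x≢y All.∷ _) AllPairs.∷ xs!) = ≤∧≢⇒< x≤y x≢y Linked.∷ strictify xs↗ xs!

sort-strict : ∀ {xs} → Unique xs → Linked _<_ (sort xs)
sort-strict {xs} xs! =
  strictify (sort-↗ xs) (Unique-resp-↭ (setoid ℕ) (↭⇒↭ₛ (↭-sym (sort-↭ xs))) xs!)

increasingFour : ∀ A → Unique A → length A ≡ 4 → All (0 <_) A →
  ∃[ a ] ∃[ b ] ∃[ c ] ∃[ d ] 0 < a × a < b × b < c × c < d × A ↭ (a ∷ b ∷ c ∷ d ∷ [])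
increasingFour A A! |A|≡4 A>0 with sort A | sort-↭ A | sort-strict A!
... | []                    | p | _ with () ← ≡.trans (↭-length p) |A|≡4
... | _ ∷ []                | p | _ with () ← ≡.trans (↭-length p) |A|≡4
... | _ ∷ _ ∷ []            | p | _ with () ← ≡.trans (↭-length p) |A|≡4
... | _ ∷ _ ∷ _ ∷ []        | p | _ with () ← ≡.trans (↭-length p) |A|≡4
... | _ ∷ _ ∷ _ ∷ _ ∷ _ ∷ _ | p | _ with () ← ≡.trans (↭-length p) |A|≡4
... | a ∷ b ∷ c ∷ d ∷ []    | p | a<b Linked.∷ b<c Linked.∷ c<d Linked.∷ [-] with 0<a All.∷ _ ← All-resp-↭ (↭-sym p) A>0 =
  a , b , c , d , 0<a , a<b , b<c , c<d , ↭-sym p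

∤-larger-summand : ∀ {x y} → 0 < y → y < x → x ∤ x + y
∤-larger-summand {x} {y} 0<y y<x x∣x+y =
  <⇒≱ y<x (∣⇒≤ {{>-nonZero 0<y}} (∣m+n∣m⇒∣n x∣x+y ∣-refl))

complementary-divisors : ∀ {x y} → x ∣ x + y → y ∣ x + y → x ≡ y
complementary-divisors {x} {y} x∣x+y y∣x+y = ∣-antisym
  (∣m+n∣m⇒∣n x∣x+y ∣-refl)
  (∣m+n∣m⇒∣n (subst (y ∣_) (+-comm x y) y∣x+y) ∣-refl)

quotient-between : ∀ {x n} m k → x ∣ n → m * x < n → n < k * x →
  ∃[ q ] m < q × q < k × n ≡ q * x
quotient-between {x} m k (divides q n≡qx) mx<n n<kx =
  q , *-cancelʳ-< x m q (subst (m * x <_) n≡qx mx<n)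
    , *-cancelʳ-< x q k (subst (_< k * x) n≡qx n<kx)
    , n≡qx

∣-pinned : ∀ {x n} m → x ∣ n → m * x < n → n < (2 + m) * x → n ≡ (1 + m) * x
∣-pinned {x} m x∣n mx<n n<[2+m]x with quotient-between m (2 + m) x∣n mx<n n<[2+m]x
... | q , m<q , q<2+m , n≡qx = ≡.trans n≡qx (cong (_* x) (≤-antisym (s≤s⁻¹ q<2+m) m<q))

∣-pinned₂ : ∀ {x n} m → x ∣ n → m * x < n → n < (3 + m) * x → n ≡ (1 + m) * x ⊎ n ≡ (2 + m) * x
∣-pinned₂ {x} m x∣n mx<n n<[3+m]x with quotient-between m (3 + m) x∣n mx<n n<[3+m]x
... | q , m<q , q<3+m , n≡qx with m≤n⇒m<n∨m≡n (s≤s⁻¹ q<3+m)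
...   | inj₁ q<2+m = inj₁ (≡.trans n≡qx (cong (_* x) (≤-antisym (s≤s⁻¹ q<2+m) m<q)))
...   | inj₂ q≡2+m = inj₂ (≡.trans n≡qx (cong (_* x) q≡2+m))

<-by-gap : ∀ {m n r} → 0 < r → m + r ≡ n → m < n
<-by-gap {m} 0<r m+r≡n = subst (m <_) m+r≡n (m<m+n m 0<r)

cancel-common : ∀ {m n} p {s t} → m ≡ p + s → n ≡ p + t → m ≡ n → s ≡ t
cancel-common p m≡p+s n≡p+t m≡n = +-cancelˡ-≡ p _ _ (≡.trans (sym m≡p+s) (≡.trans m≡n n≡p+t))

extremal₁ extremal₂ : ℕ → List ℕ
extremal₁ a = a ∷ 5 * a ∷ 7 * a ∷ 11 * a ∷ []
extremal₂ a = a ∷ 11 * a ∷ 19 * a ∷ 29 * a ∷ []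

tail-cong : ∀ {a b c d b′ c′ d′ : ℕ} → b ≡ b′ → c ≡ c′ → d ≡ d′ →
  (a ∷ b ∷ c ∷ d ∷ []) ≡ (a ∷ b′ ∷ c′ ∷ d′ ∷ [])
tail-cong ≡.refl ≡.refl ≡.refl = ≡.refl

-- Gap coordinates of a balanced quadruple: b = a + u, c = b + v, d = c + u, with x = a + c and n = S.
gap-balance : ∀ {x n} a u v → 0 < a → 0 < u →
  x ≡ 2 * a + u + v → n ≡ 4 * a + 4 * u + 2 * v → x ∣ n → u ≡ 2 * a + v
gap-balance a u v 0<a 0<u ≡.refl ≡.refl x∣n =
  cancel-common (4 * a + 3 * u + 2 * v) n≡ 3x≡ (∣-pinned 2 x∣n lo hi)
  where
  n≡ : 4 * a + 4 * u + 2 * v ≡ (4 * a + 3 * u + 2 * v) + u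
  n≡ = solve (a ∷ u ∷ v ∷ [])
  3x≡ : 3 * (2 * a + u + v) ≡ (4 * a + 3 * u + 2 * v) + (2 * a + v)
  3x≡ = solve (a ∷ u ∷ v ∷ [])
  lo≡ : 2 * (2 * a + u + v) + (u + u) ≡ 4 * a + 4 * u + 2 * v
  lo≡ = solve (a ∷ u ∷ v ∷ [])
  lo : 2 * (2 * a + u + v) < 4 * a + 4 * u + 2 * v
  lo = <-by-gap (<-≤-trans 0<u (m≤m+n u u)) lo≡
  hi≡ : 4 * a + 4 * u + 2 * v + (a + (3 * a + 2 * v)) ≡ 4 * (2 * a + u + v)
  hi≡ = solve (a ∷ u ∷ v ∷ [])
  hi : 4 * a + 4 * u + 2 * v < 4 * (2 * a + u + v)
  hi = <-by-gap (<-≤-trans 0<a (m≤m+n a (3 * a + 2 * v))) hi≡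

-- The same quadruple after u = 2a + v, with x = a + b and n = S.
gap-scale : ∀ {x n} a v → 0 < a → 0 < v →
  x ≡ 4 * a + v → n ≡ 12 * a + 6 * v → x ∣ n → v ≡ 2 * a ⊎ v ≡ 8 * a
gap-scale a v 0<a 0<v ≡.refl ≡.refl x∣n = Sum.map quotient-4 quotient-5 (∣-pinned₂ 3 x∣n lo hi)
  where
  lo≡ : 3 * (4 * a + v) + (v + (v + v)) ≡ 12 * a + 6 * v
  lo≡ = solve (a ∷ v ∷ [])
  lo : 3 * (4 * a + v) < 12 * a + 6 * v
  lo = <-by-gap (<-≤-trans 0<v (m≤m+n v (v + v))) lo≡
  hi≡ : 12 * a + 6 * v + (a + 11 * a) ≡ 6 * (4 * a + v)
  hi≡ = solve (a ∷ v ∷ [])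
  hi : 12 * a + 6 * v < 6 * (4 * a + v)
  hi = <-by-gap (<-≤-trans 0<a (m≤m+n a (11 * a))) hi≡
  4-n≡ : 12 * a + 6 * v ≡ (12 * a + 4 * v) + 2 * v
  4-n≡ = solve (a ∷ v ∷ [])
  4x≡ : 4 * (4 * a + v) ≡ (12 * a + 4 * v) + 2 * (2 * a)
  4x≡ = solve (a ∷ v ∷ [])
  quotient-4 : 12 * a + 6 * v ≡ 4 * (4 * a + v) → v ≡ 2 * a
  quotient-4 n≡4x = *-cancelˡ-≡ v (2 * a) 2 (cancel-common (12 * a + 4 * v) 4-n≡ 4x≡ n≡4x)
  5-n≡ : 12 * a + 6 * v ≡ (12 * a + 5 * v) + v
  5-n≡ = solve (a ∷ v ∷ [])
  5x≡ : 5 * (4 * a + v) ≡ (12 * a + 5 * v) + 8 * a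
  5x≡ = solve (a ∷ v ∷ [])
  quotient-5 : 12 * a + 6 * v ≡ 5 * (4 * a + v) → v ≡ 8 * a
  quotient-5 = cancel-common (12 * a + 5 * v) 5-n≡ 5x≡

extremal-by-gaps : ∀ {a b c d} u v → 0 < a → 0 < u → 0 < v →
  b ≡ a + u → c ≡ b + v → d ≡ c + u →
  a + b ∣ sum (a ∷ b ∷ c ∷ d ∷ []) → a + c ∣ sum (a ∷ b ∷ c ∷ d ∷ []) →
  (a ∷ b ∷ c ∷ d ∷ []) ≡ extremal₁ a ⊎ (a ∷ b ∷ c ∷ d ∷ []) ≡ extremal₂ a
extremal-by-gaps {a} u v 0<a 0<u 0<v ≡.refl ≡.refl ≡.refl a+b∣S a+c∣S
  with gap-balance a u v 0<a 0<u a+c≡ S≡₁ a+c∣S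
  where
  S≡₁ : a + ((a + u) + ((a + u + v) + ((a + u + v + u) + 0))) ≡ 4 * a + 4 * u + 2 * v
  S≡₁ = solve (a ∷ u ∷ v ∷ [])
  a+c≡ : a + (a + u + v) ≡ 2 * a + u + v
  a+c≡ = solve (a ∷ u ∷ v ∷ [])
... | ≡.refl = Sum.map scale-2 scale-8 (gap-scale a v 0<a 0<v a+b≡ S≡₂ a+b∣S)
  where
  S≡₂ : a + ((a + (2 * a + v)) + ((a + (2 * a + v) + v) + ((a + (2 * a + v) + v + (2 * a + v)) + 0)))
        ≡ 12 * a + 6 * v
  S≡₂ = solve (a ∷ v ∷ [])
  a+b≡ : a + (a + (2 * a + v)) ≡ 4 * a + v
  a+b≡ = solve (a ∷ v ∷ [])
  scale-2 : v ≡ 2 * a → (a ∷ a + (2 * a + v) ∷ a + (2 * a + v) + v ∷ a + (2 * a + v) + v + (2 * a + v) ∷ []) ≡ extremal₁ a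
  scale-2 ≡.refl = tail-cong (solve (a ∷ [])) (solve (a ∷ [])) (solve (a ∷ []))
  scale-8 : v ≡ 8 * a → (a ∷ a + (2 * a + v) ∷ a + (2 * a + v) + v ∷ a + (2 * a + v) + v + (2 * a + v) ∷ []) ≡ extremal₂ a
  scale-8 ≡.refl = tail-cong (solve (a ∷ [])) (solve (a ∷ [])) (solve (a ∷ []))

module IncreasingFour {a b c d : ℕ} (a<b : a < b) (b<c : b < c) (c<d : c < d) where

  S : ℕ
  S = sum (a ∷ b ∷ c ∷ d ∷ [])

  smallSums largeSums : List ℕ
  smallSums = a + b ∷ a + c ∷ a + d ∷ b + c ∷ []
  largeSums = b + d ∷ c + d ∷ []

  0<b : 0 < b
  0<b = <-≤-trans (s≤s z≤n) a<b

  b+d∤S : b + d ∤ S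
  b+d∤S = subst (b + d ∤_) S≡ (∤-larger-summand (<-≤-trans (<-trans 0<b b<c) (m≤n+m c a)) (+-mono-< a<b c<d))
    where
    S≡ : (b + d) + (a + c) ≡ a + (b + (c + (d + 0)))
    S≡ = solve (a ∷ b ∷ c ∷ d ∷ [])

  c+d∤S : c + d ∤ S
  c+d∤S = subst (c + d ∤_) S≡ (∤-larger-summand (<-≤-trans 0<b (m≤n+m b a)) (+-mono-< (<-trans a<b b<c) (<-trans b<c c<d)))
    where
    S≡ : (c + d) + (a + b) ≡ a + (b + (c + (d + 0)))
    S≡ = solve (a ∷ b ∷ c ∷ d ∷ [])

  d₂≡smallSums : d₂ (a ∷ b ∷ c ∷ d ∷ []) ≡ length (filter (_∣? S) smallSums)
  d₂≡smallSums = begin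
    d₂ (a ∷ b ∷ c ∷ d ∷ [])                                           ≡⟨ d₂-pairSums (a ∷ b ∷ c ∷ d ∷ []) ⟩
    length (filter (_∣? S) (smallSums ++ largeSums))                  ≡⟨ cong length (filter-++ (_∣? S) smallSums largeSums) ⟩
    length (filter (_∣? S) smallSums ++ filter (_∣? S) largeSums)     ≡⟨ cong (λ ys → length (filter (_∣? S) smallSums ++ ys)) (filter-none (_∣? S) (b+d∤S All.∷ c+d∤S All.∷ All.[])) ⟩
    length (filter (_∣? S) smallSums ++ [])                           ≡⟨ cong length (++-identityʳ (filter (_∣? S) smallSums)) ⟩
    length (filter (_∣? S) smallSums)                                 ∎

  d₂≤4 : d₂ (a ∷ b ∷ c ∷ d ∷ []) ≤ 4
  d₂≤4 = subst (_≤ 4) (sym d₂≡smallSums) (length-filter (_∣? S) smallSums)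

  d₂≡4⇔smallSums∣S : d₂ (a ∷ b ∷ c ∷ d ∷ []) ≡ 4 ⇔ All (_∣ S) smallSums
  d₂≡4⇔smallSums∣S = mk⇔
    (λ d₂≡4 → subst (All (_∣ S)) (filter-complete (_∣? S) (≡.trans (sym d₂≡smallSums) d₂≡4))
                                 (all-filter (_∣? S) smallSums))
    (λ all∣ → ≡.trans d₂≡smallSums (cong length (filter-all (_∣? S) all∣)))

  a+d≡b+c : a + d ∣ S → b + c ∣ S → a + d ≡ b + c
  a+d≡b+c a+d∣S b+c∣S = complementary-divisors (subst (a + d ∣_) S≡ a+d∣S) (subst (b + c ∣_) S≡ b+c∣S)
    where
    S≡ : a + (b + (c + (d + 0))) ≡ (a + d) + (b + c)
    S≡ = solve (a ∷ b ∷ c ∷ d ∷ [])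

  classify : 0 < a → All (_∣ S) smallSums →
    (a ∷ b ∷ c ∷ d ∷ []) ≡ extremal₁ a ⊎ (a ∷ b ∷ c ∷ d ∷ []) ≡ extremal₂ a
  classify 0<a (a+b∣S All.∷ a+c∣S All.∷ a+d∣S All.∷ b+c∣S All.∷ All.[]) =
    extremal-by-gaps (b ∸ a) (c ∸ b) 0<a (m<n⇒0<n∸m a<b) (m<n⇒0<n∸m b<c)
      (sym (m+[n∸m]≡n (<⇒≤ a<b))) (sym (m+[n∸m]≡n (<⇒≤ b<c))) d≡c+[b∸a] a+b∣S a+c∣S
    where
    d≡c+[b∸a] : d ≡ c + (b ∸ a)
    d≡c+[b∸a] = +-cancelˡ-≡ a d (c + (b ∸ a)) (begin
      a + d             ≡⟨ a+d≡b+c a+d∣S b+c∣S ⟩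
      b + c             ≡⟨ cong (_+ c) (sym (m+[n∸m]≡n (<⇒≤ a<b))) ⟩
      a + (b ∸ a) + c   ≡⟨ +-assoc a (b ∸ a) c ⟩
      a + (b ∸ a + c)   ≡⟨ cong (a +_) (+-comm (b ∸ a) c) ⟩
      a + (c + (b ∸ a)) ∎)

d₂-extremal₁ : ∀ a → 0 < a → d₂ (extremal₁ a) ≡ 4
d₂-extremal₁ a 0<a = ≡.trans (cong (λ x → d₂ (x ∷ 5 * a ∷ 7 * a ∷ 11 * a ∷ [])) (sym (*-identityˡ a)))
                             (d₂-map-* a {{>-nonZero 0<a}} (1 ∷ 5 ∷ 7 ∷ 11 ∷ []))

d₂-extremal₂ : ∀ a → 0 < a → d₂ (extremal₂ a) ≡ 4
d₂-extremal₂ a 0<a = ≡.trans (cong (λ x → d₂ (x ∷ 11 * a ∷ 19 * a ∷ 29 * a ∷ [])) (sym (*-identityˡ a)))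
                             (d₂-map-* a {{>-nonZero 0<a}} (1 ∷ 11 ∷ 19 ∷ 29 ∷ []))

mainTheorem3 : (A : List ℕ) → Unique A → length A ≡ 4 → All (0 <_) A →
    (d₂ A ≤ 4) ×
    (d₂ A ≡ 4 ⇔ Σ ℕ (λ a → 0 < a ×
        (A ↭ (a ∷ 5 * a ∷ 7 * a ∷ 11 * a ∷ [])
         ⊎ A ↭ (a ∷ 11 * a ∷ 19 * a ∷ 29 * a ∷ []))))
mainTheorem3 A A! |A|≡4 A>0 with increasingFour A A! |A|≡4 A>0
... | a , b , c , d , 0<a , a<b , b<c , c<d , A↭abcd =
  subst (_≤ 4) (sym d₂A≡) d₂≤4 , mk⇔ extremal-of-d₂≡4 d₂≡4-of-extremal
  where
  open IncreasingFour a<b b<c c<d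
  d₂A≡ : d₂ A ≡ d₂ (a ∷ b ∷ c ∷ d ∷ [])
  d₂A≡ = d₂-↭ A↭abcd
  extremal-of-d₂≡4 : d₂ A ≡ 4 → Σ ℕ (λ e → 0 < e × (A ↭ extremal₁ e ⊎ A ↭ extremal₂ e))
  extremal-of-d₂≡4 d₂A≡4 = a , 0<a ,
    Sum.map (λ eq → subst (A ↭_) eq A↭abcd) (λ eq → subst (A ↭_) eq A↭abcd)
            (classify 0<a (Equivalence.to d₂≡4⇔smallSums∣S (≡.trans (sym d₂A≡) d₂A≡4)))
  d₂≡4-of-extremal : Σ ℕ (λ e → 0 < e × (A ↭ extremal₁ e ⊎ A ↭ extremal₂ e)) → d₂ A ≡ 4
  d₂≡4-of-extremal (e , 0<e , inj₁ A↭) = ≡.trans (d₂-↭ A↭) (d₂-extremal₁ e 0<e)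
  d₂≡4-of-extremal (e , 0<e , inj₂ A↭) = ≡.trans (d₂-↭ A↭) (d₂-extremal₂ e 0<e)
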